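{- Let $\mathcal{M}$ be an $n$-maniplex with at least two facets and let $\mathcal{G}$ be an $(n+1)$-regular pregraph with edges labelled in $\{0,\ldots,n\}$ that can be obtained from the symmetry type graph $T(\mathcal{M})$ by one of the following two procedures: (1) add a semi-edge labelled $n$ at every vertex; (2) add $1$ to the label of every edge and add a semi-edge labelled $0$ at every vertex. Then $\mathcal{G}$ is the symmetry type graph of some maniplex $\mathcal{M}'$.
   Context: An $n$-maniplex is a pair $(\mathcal{F},\{r_0,\ldots,r_{n-1}\})$ where $\mathcal{F}$ is a non-empty set of flags and $r_0,\ldots,r_{n-1}$ are fixed-point-free involutory permutations of $\mathcal{F}$ such that $\langle r_0,\ldots,r_{n-1}\rangle$ is transitive on $\mathcal{F}$, $\Phi^{r_i}\neq\Phi^{r_j}$ for all $\Phi$ and $i\ne j$, and $r_ir_j=r_jr_i$ whenever $|i-j|\ge2$. The facets are the orbits of $\langle r_0,\ldots,r_{n-2}\rangle$. An automorphism is a permutation of $\mathcal{F}$ commuting with every $r_i$. The symmetry type graph $T(\mathcal{M})$ is the edge-labelled pregraph whose vertices are the $\mathrm{Aut}(\mathcal{M})$-orbits on flags, where for each label $i$ and orbit $O$ (letting $O^{r_i}$ be the orbit containing $\Phi^{r_i}$ for $\Phi\in O$, which is well defined) $O$ carries a semi-edge labelled $i$ if $O^{r_i}=O$, and otherwise $O$ and $O^{r_i}$ are joined by an edge labelled $i$. -}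

module Defs where

open import Data.Nat using (ℕ; zero; suc; _≤_; _<_; ∣_-_∣)
open import Data.Fin using (Fin; zero; suc; toℕ)
open import Data.List using (List; []; _∷_)
open import Data.List.Relation.Unary.All using (All)
open import Data.Product using (Σ; _×_; ∃)
open import Function using (id; _∘_)
open import Function.Bundles using (_⇔_)
open import Relation.Binary.PropositionalEquality using (_≡_; _≢_; refl)
open import Relation.Nullary using (¬_)

act : {F : Set} {n : ℕ} → (Fin n → F → F) → List (Fin n) → F → F
act r []      Φ = Φ
act r (i ∷ w) Φ = act r w (r i Φ)

record Maniplex (n : ℕ) : Set₁ where
  field
    Flag      : Set
    base      : Flag
    r         : Fin n → Flag → Flag
    r-invol   : ∀ i Φ → r i (r i Φ) ≡ Φ
    r-fpf     : ∀ i Φ → r i Φ ≢ Φ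
    r-distinct : ∀ i j Φ → i ≢ j → r i Φ ≢ r j Φ
    r-comm    : ∀ i j → 2 ≤ ∣ toℕ i - toℕ j ∣ → ∀ Φ → r i (r j Φ) ≡ r j (r i Φ)
    transitive : ∀ Φ Ψ → ∃ λ (w : List (Fin n)) → act r w Φ ≡ Ψ

module _ {n : ℕ} (M : Maniplex n) where
  open Maniplex M

  -- Φ and Ψ lie in the same orbit of ⟨r_0,…,r_{n-2}⟩, i.e. in the same facet
  SameFacet : Flag → Flag → Set
  SameFacet Φ Ψ = ∃ λ (w : List (Fin n)) →
    All (λ i → suc (toℕ i) < n) w × act r w Φ ≡ Ψ

  AtLeastTwoFacets : Set
  AtLeastTwoFacets = Σ Flag λ Φ → Σ Flag λ Ψ → ¬ SameFacet Φ Ψ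

  record Automorphism : Set where
    field
      fun     : Flag → Flag
      inv     : Flag → Flag
      inv-l   : ∀ Φ → inv (fun Φ) ≡ Φ
      inv-r   : ∀ Φ → fun (inv Φ) ≡ Φ
      commute : ∀ i Φ → fun (r i Φ) ≡ r i (fun Φ)

  SameOrbit : Flag → Flag → Set
  SameOrbit Φ Ψ = Σ Automorphism λ α → Automorphism.fun α Φ ≡ Ψ

-- Edge-labelled pregraphs with labels in Fin k in which every vertex has
-- exactly one dart of each label: adj i v is the other end of the
-- i-edge at v (adj i v ≡ v means a semi-edge labelled i at v).

record Pregraph (k : ℕ) : Set₁ where
  field
    V         : Set
    adj       : Fin k → V → V
    adj-invol : ∀ i v → adj i (adj i v) ≡ v

record PregraphIso {k : ℕ} (G H : Pregraph k) : Set where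
  field
    to      : Pregraph.V G → Pregraph.V H
    from    : Pregraph.V H → Pregraph.V G
    from-to : ∀ v → from (to v) ≡ v
    to-from : ∀ w → to (from w) ≡ w
    preserve : ∀ i v → to (Pregraph.adj G i v) ≡ Pregraph.adj H i (to v)

-- T is (isomorphic to) the symmetry type graph T(M): the vertices of T
-- are exactly the Aut(M)-orbits of flags (via the surjection π), and the
-- i-neighbour of the orbit of Φ is the orbit of Φ^{r_i}.
IsSymmetryTypeGraph : {n : ℕ} → Maniplex n → Pregraph n → Set
IsSymmetryTypeGraph M T =
  Σ (Maniplex.Flag M → Pregraph.V T) λ π →
    (∀ v → ∃ λ Φ → π Φ ≡ v) ×
    (∀ Φ Ψ → (π Φ ≡ π Ψ) ⇔ SameOrbit M Φ Ψ) ×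
    (∀ i Φ → π (Maniplex.r M i Φ) ≡ Pregraph.adj T i (π Φ))

addLast : {V : Set} {n : ℕ} → (Fin n → V → V) → Fin (suc n) → V → V
addLast {n = zero}  f zero    = id
addLast {n = suc n} f zero    = f zero
addLast {n = suc n} f (suc i) = addLast (f ∘ suc) i

addLast-invol : {V : Set} {n : ℕ} (f : Fin n → V → V) →
  (∀ i v → f i (f i v) ≡ v) → ∀ i v → addLast f i (addLast f i v) ≡ v
addLast-invol {n = zero}  f p zero    v = refl
addLast-invol {n = suc n} f p zero    v = p zero v
addLast-invol {n = suc n} f p (suc i) v = addLast-invol (f ∘ suc) (p ∘ suc) i v

procedure1 : {n : ℕ} → Pregraph n → Pregraph (suc n)
procedure1 T = record
  { V = Pregraph.V T
  ; adj = addLast (Pregraph.adj T)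
  ; adj-invol = addLast-invol (Pregraph.adj T) (Pregraph.adj-invol T)
  }

shiftAdj : {V : Set} {n : ℕ} → (Fin n → V → V) → Fin (suc n) → V → V
shiftAdj f zero    = id
shiftAdj f (suc i) = f i

procedure2 : {n : ℕ} → Pregraph n → Pregraph (suc n)
procedure2 T = record
  { V = Pregraph.V T
  ; adj = shiftAdj (Pregraph.adj T)
  ; adj-invol = λ { zero v → refl ; (suc i) v → Pregraph.adj-invol T i v }
  }

-- The trivial extension M′ of M has flags {0,1} × F(M): the old generators act on the
-- second coordinate and the new one flips the bit. Its automorphisms are exactly
-- Aut(M) × ℤ₂ (an automorphism commuting with the flip cannot depend on the bit),
-- so its flag orbits are those of M and the new label is a semi-edge at every
-- orbit. Placing the new label last or first gives the two procedures.
module Submission where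

open import Defs
open import Data.Nat using (ℕ; zero; suc; _≤_; ∣_-_∣)
open import Data.Fin using (Fin; zero; suc; toℕ; fromℕ; inject₁)
open import Data.Fin.Properties using (toℕ-inject₁)
open import Data.Fin.Relation.Unary.Top using (view; ‵fromℕ; ‵inject₁)
open import Data.Bool using (Bool; false; true; not; _xor_)
open import Data.Bool.Properties
  using (not-¬; not-involutive; not-distribˡ-xor; xor-assoc; xor-same; xor-identityʳ)
open import Data.List using (List; []; _∷_; map; _++_)
open import Data.Product using (Σ; ∃; _×_; _,_; proj₁; proj₂; map₁; map₂)
open import Data.Sum using (_⊎_; inj₁; inj₂)
open import Function using (_∘_; id)
open import Function.Bundles using (_⇔_; mk⇔; Equivalence)
open import Function.Construct.Composition using (_⇔-∘_)
open import Function.Construct.Symmetry using (⇔-sym)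
open import Relation.Binary.PropositionalEquality
open ≡-Reasoning

xor-cancelˡ : ∀ x y → x xor (x xor y) ≡ y
xor-cancelˡ x y = trans (sym (xor-assoc x x y)) (cong (_xor y) (xor-same x))

xor-cancelʳ : ∀ x y → (x xor y) xor y ≡ x
xor-cancelʳ x y = trans (xor-assoc x y y) (trans (cong (x xor_) (xor-same y)) (xor-identityʳ x))

act-++ : ∀ {F : Set} {n} (r : Fin n → F → F) w v x → act r (w ++ v) x ≡ act r v (act r w x)
act-++ r []      v x = refl
act-++ r (i ∷ w) v x = act-++ r w v (r i x)

isSymmetryTypeGraph-resp-iso : ∀ {n} {M : Maniplex n} {G H : Pregraph n} →
  PregraphIso G H → IsSymmetryTypeGraph M H → IsSymmetryTypeGraph M G
isSymmetryTypeGraph-resp-iso {M = M} {G} {H} iso (π , π-surj , π-orbits , π-adj) =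
  from ∘ π , surj , orbits , adj
  where
  open PregraphIso iso

  surj : ∀ v → ∃ λ Φ → from (π Φ) ≡ v
  surj v = let Φ , πΦ≡tov = π-surj (to v) in Φ , trans (cong from πΦ≡tov) (from-to v)

  from-injective : ∀ {u w} → from u ≡ from w → u ≡ w
  from-injective {u} {w} e = trans (sym (to-from u)) (trans (cong to e) (to-from w))

  orbits : ∀ Φ Ψ → (from (π Φ) ≡ from (π Ψ)) ⇔ SameOrbit M Φ Ψ
  orbits Φ Ψ = mk⇔ (Equivalence.to (π-orbits Φ Ψ) ∘ from-injective)
                   (cong from ∘ Equivalence.from (π-orbits Φ Ψ))

  from-preserve : ∀ i w → from (Pregraph.adj H i w) ≡ Pregraph.adj G i (from w)
  from-preserve i w = begin
    from (Pregraph.adj H i w)              ≡⟨ cong (from ∘ Pregraph.adj H i) (to-from w) ⟨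
    from (Pregraph.adj H i (to (from w)))  ≡⟨ cong from (preserve i (from w)) ⟨
    from (to (Pregraph.adj G i (from w)))  ≡⟨ from-to _ ⟩
    Pregraph.adj G i (from w)              ∎

  adj : ∀ i Φ → from (π (Maniplex.r M i Φ)) ≡ Pregraph.adj G i (from (π Φ))
  adj i Φ = trans (cong from (π-adj i Φ)) (from-preserve i (π Φ))

sameVertices-iso : ∀ {k} {V : Set} (a b : Fin k → V → V)
  (a-invol : ∀ i v → a i (a i v) ≡ v) (b-invol : ∀ i v → b i (b i v) ≡ v) →
  (∀ i v → a i v ≡ b i v) →
  PregraphIso (record { V = V ; adj = a ; adj-invol = a-invol })
              (record { V = V ; adj = b ; adj-invol = b-invol })
sameVertices-iso a b a-invol b-invol a≗b = record
  { to = id ; from = id ; from-to = λ _ → refl ; to-from = λ _ → refl ; preserve = a≗b }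

record NewLabel (n : ℕ) : Set₁ where
  field
    old      : Fin n → Fin (suc n)
    new      : Fin (suc n)
    split    : ∀ i → i ≡ new ⊎ ∃ λ j → i ≡ old j
    old-dist : ∀ j k → ∣ toℕ (old j) - toℕ (old k) ∣ ≡ ∣ toℕ j - toℕ k ∣
    insert   : {A : Set} → (Fin n → A → A) → (A → A) → Fin (suc n) → A → A
    insert-old : ∀ {A} (f : Fin n → A → A) g j x → insert f g (old j) x ≡ f j x
    insert-new : ∀ {A} (f : Fin n → A → A) g x → insert f g new x ≡ g x

  insert-invol : ∀ {A} (f : Fin n → A → A) (g : A → A) →
    (∀ j x → f j (f j x) ≡ x) → (∀ x → g (g x) ≡ x) →
    ∀ i x → insert f g i (insert f g i x) ≡ x
  insert-invol f g f-invol g-invol i x with split i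
  ... | inj₁ refl = trans (insert-new f g _) (trans (cong g (insert-new f g x)) (g-invol x))
  ... | inj₂ (j , refl) =
    trans (insert-old f g j _) (trans (cong (f j) (insert-old f g j x)) (f-invol j x))

  addSemiEdges : Pregraph n → Pregraph (suc n)
  addSemiEdges T = record
    { V = Pregraph.V T
    ; adj = insert (Pregraph.adj T) id
    ; adj-invol = insert-invol (Pregraph.adj T) id (Pregraph.adj-invol T) (λ _ → refl)
    }

insertLast : ∀ {A : Set} {n} → (Fin n → A → A) → (A → A) → Fin (suc n) → A → A
insertLast {n = zero}  f g zero    = g
insertLast {n = suc n} f g zero    = f zero
insertLast {n = suc n} f g (suc i) = insertLast (f ∘ suc) g i

insertLast-inject₁ : ∀ {A : Set} {n} (f : Fin n → A → A) g j x →
  insertLast f g (inject₁ j) x ≡ f j x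
insertLast-inject₁ {n = suc n} f g zero    x = refl
insertLast-inject₁ {n = suc n} f g (suc j) x = insertLast-inject₁ (f ∘ suc) g j x

insertLast-fromℕ : ∀ {A : Set} {n} (f : Fin n → A → A) g x →
  insertLast f g (fromℕ n) x ≡ g x
insertLast-fromℕ {n = zero}  f g x = refl
insertLast-fromℕ {n = suc n} f g x = insertLast-fromℕ (f ∘ suc) g x

lastLabel : ∀ n → NewLabel n
lastLabel n = record
  { old = inject₁
  ; new = fromℕ n
  ; split = split
  ; old-dist = λ j k → cong₂ ∣_-_∣ (toℕ-inject₁ j) (toℕ-inject₁ k)
  ; insert = insertLast
  ; insert-old = insertLast-inject₁
  ; insert-new = insertLast-fromℕ
  }
  where
  split : ∀ i → i ≡ fromℕ n ⊎ ∃ λ j → i ≡ inject₁ j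
  split i with view i
  ... | ‵fromℕ     = inj₁ refl
  ... | ‵inject₁ j = inj₂ (j , refl)

insertFirst : ∀ {A : Set} {n} → (Fin n → A → A) → (A → A) → Fin (suc n) → A → A
insertFirst f g zero    = g
insertFirst f g (suc j) = f j

firstLabel : ∀ n → NewLabel n
firstLabel n = record
  { old = suc
  ; new = zero
  ; split = λ { zero → inj₁ refl ; (suc j) → inj₂ (j , refl) }
  ; old-dist = λ _ _ → refl
  ; insert = insertFirst
  ; insert-old = λ _ _ _ _ → refl
  ; insert-new = λ _ _ _ → refl
  }

addLast≗insertLast : ∀ {A : Set} {n} (f : Fin n → A → A) i x →
  addLast f i x ≡ insertLast f id i x
addLast≗insertLast {n = zero}  f zero    x = refl
addLast≗insertLast {n = suc n} f zero    x = refl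
addLast≗insertLast {n = suc n} f (suc i) x = addLast≗insertLast (f ∘ suc) i x

shiftAdj≗insertFirst : ∀ {A : Set} {n} (f : Fin n → A → A) i x →
  shiftAdj f i x ≡ insertFirst f id i x
shiftAdj≗insertFirst f zero    x = refl
shiftAdj≗insertFirst f (suc i) x = refl

procedure1≅addSemiEdges : ∀ {n} (T : Pregraph n) →
  PregraphIso (procedure1 T) (NewLabel.addSemiEdges (lastLabel n) T)
procedure1≅addSemiEdges T = sameVertices-iso _ _ _ _ (addLast≗insertLast (Pregraph.adj T))

procedure2≅addSemiEdges : ∀ {n} (T : Pregraph n) →
  PregraphIso (procedure2 T) (NewLabel.addSemiEdges (firstLabel n) T)
procedure2≅addSemiEdges T = sameVertices-iso _ _ _ _ (shiftAdj≗insertFirst (Pregraph.adj T))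

module TrivialExtension {n : ℕ} (E : NewLabel n) (M : Maniplex n) where
  open NewLabel E
  open Maniplex M

  r′ : Fin (suc n) → Bool × Flag → Bool × Flag
  r′ = insert (λ j → map₂ (r j)) (map₁ not)

  r′-old : ∀ j b Φ → r′ (old j) (b , Φ) ≡ (b , r j Φ)
  r′-old j b Φ = insert-old (λ j → map₂ (r j)) (map₁ not) j (b , Φ)

  r′-new : ∀ b Φ → r′ new (b , Φ) ≡ (not b , Φ)
  r′-new b Φ = insert-new (λ j → map₂ (r j)) (map₁ not) (b , Φ)

  r′-invol : ∀ i x → r′ i (r′ i x) ≡ x
  r′-invol = insert-invol _ _ (λ j (b , Φ) → cong (b ,_) (r-invol j Φ))
                              (λ (b , Φ) → cong (_, Φ) (not-involutive b))

  r′-fpf : ∀ i x → r′ i x ≢ x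
  r′-fpf i (b , Φ) e with split i
  ... | inj₁ refl       = not-¬ refl (sym (cong proj₁ (trans (sym (r′-new b Φ)) e)))
  ... | inj₂ (j , refl) = r-fpf j Φ (cong proj₂ (trans (sym (r′-old j b Φ)) e))

  r′-new≢old : ∀ j x → r′ new x ≢ r′ (old j) x
  r′-new≢old j (b , Φ) e =
    not-¬ refl (sym (cong proj₁ (trans (sym (r′-new b Φ)) (trans e (r′-old j b Φ)))))

  r′-distinct : ∀ i k x → i ≢ k → r′ i x ≢ r′ k x
  r′-distinct i k (b , Φ) i≢k e with split i | split k
  ... | inj₁ refl       | inj₁ refl       = i≢k refl
  ... | inj₁ refl       | inj₂ (c , refl) = r′-new≢old c (b , Φ) e
  ... | inj₂ (a , refl) | inj₁ refl       = r′-new≢old a (b , Φ) (sym e)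
  ... | inj₂ (a , refl) | inj₂ (c , refl) = r-distinct a c Φ (i≢k ∘ cong old)
    (cong proj₂ (trans (sym (r′-old a b Φ)) (trans e (r′-old c b Φ))))

  r′-new-comm-old : ∀ j x → r′ new (r′ (old j) x) ≡ r′ (old j) (r′ new x)
  r′-new-comm-old j (b , Φ) = begin
    r′ new (r′ (old j) (b , Φ))  ≡⟨ cong (r′ new) (r′-old j b Φ) ⟩
    r′ new (b , r j Φ)           ≡⟨ r′-new b (r j Φ) ⟩
    (not b , r j Φ)              ≡⟨ r′-old j (not b) Φ ⟨
    r′ (old j) (not b , Φ)       ≡⟨ cong (r′ (old j)) (r′-new b Φ) ⟨
    r′ (old j) (r′ new (b , Φ))  ∎

  r′-old-comm-old : ∀ a c → 2 ≤ ∣ toℕ a - toℕ c ∣ →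
    ∀ x → r′ (old a) (r′ (old c) x) ≡ r′ (old c) (r′ (old a) x)
  r′-old-comm-old a c far (b , Φ) = begin
    r′ (old a) (r′ (old c) (b , Φ))  ≡⟨ cong (r′ (old a)) (r′-old c b Φ) ⟩
    r′ (old a) (b , r c Φ)           ≡⟨ r′-old a b (r c Φ) ⟩
    (b , r a (r c Φ))                ≡⟨ cong (b ,_) (r-comm a c far Φ) ⟩
    (b , r c (r a Φ))                ≡⟨ r′-old c b (r a Φ) ⟨
    r′ (old c) (b , r a Φ)           ≡⟨ cong (r′ (old c)) (r′-old a b Φ) ⟨
    r′ (old c) (r′ (old a) (b , Φ))  ∎

  r′-comm : ∀ i k → 2 ≤ ∣ toℕ i - toℕ k ∣ → ∀ x → r′ i (r′ k x) ≡ r′ k (r′ i x)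
  r′-comm i k far x with split i | split k
  ... | inj₁ refl       | inj₁ refl       = refl
  ... | inj₁ refl       | inj₂ (c , refl) = r′-new-comm-old c x
  ... | inj₂ (a , refl) | inj₁ refl       = sym (r′-new-comm-old a x)
  ... | inj₂ (a , refl) | inj₂ (c , refl) =
    r′-old-comm-old a c (subst (2 ≤_) (old-dist a c) far) x

  act-map-old : ∀ w b Φ → act r′ (map old w) (b , Φ) ≡ (b , act r w Φ)
  act-map-old []      b Φ = refl
  act-map-old (j ∷ w) b Φ =
    trans (cong (act r′ (map old w)) (r′-old j b Φ)) (act-map-old w b (r j Φ))

  setBit : ∀ b c → Σ (List (Fin (suc n))) λ v → ∀ Φ → act r′ v (b , Φ) ≡ (c , Φ)
  setBit false false = [] , λ _ → refl
  setBit true  true  = [] , λ _ → refl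
  setBit false true  = new ∷ [] , r′-new false
  setBit true  false = new ∷ [] , r′-new true

  r′-transitive : ∀ x y → ∃ λ (w : List (Fin (suc n))) → act r′ w x ≡ y
  r′-transitive (b , Φ) (c , Ψ) =
    let w , wΦ≡Ψ = transitive Φ Ψ
        v , v-sets = setBit b c
    in map old w ++ v , (begin
      act r′ (map old w ++ v) (b , Φ)       ≡⟨ act-++ r′ (map old w) v (b , Φ) ⟩
      act r′ v (act r′ (map old w) (b , Φ)) ≡⟨ cong (act r′ v) (act-map-old w b Φ) ⟩
      act r′ v (b , act r w Φ)              ≡⟨ v-sets (act r w Φ) ⟩
      (c , act r w Φ)                       ≡⟨ cong (c ,_) wΦ≡Ψ ⟩
      (c , Ψ)                               ∎)

  maniplex : Maniplex (suc n)
  maniplex = record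
    { Flag = Bool × Flag
    ; base = false , base
    ; r = r′
    ; r-invol = r′-invol
    ; r-fpf = r′-fpf
    ; r-distinct = r′-distinct
    ; r-comm = r′-comm
    ; transitive = r′-transitive
    }

  Commutes : (Bool × Flag → Bool × Flag) → Set
  Commutes h = ∀ i x → h (r′ i x) ≡ r′ i (h x)

  proj₂-bit-irrelevant : ∀ h → Commutes h →
    ∀ b Φ → proj₂ (h (b , Φ)) ≡ proj₂ (h (false , Φ))
  proj₂-bit-irrelevant h h-comm false Φ = refl
  proj₂-bit-irrelevant h h-comm true  Φ = cong proj₂ (begin
    h (true , Φ)                         ≡⟨ cong h (r′-new false Φ) ⟨
    h (r′ new (false , Φ))               ≡⟨ h-comm new (false , Φ) ⟩
    r′ new (h (false , Φ))               ≡⟨ r′-new _ _ ⟩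
    (not (proj₁ (h (false , Φ))) , proj₂ (h (false , Φ))) ∎)

  module _ (α : Automorphism maniplex) where
    open Automorphism α

    inv-commutes : Commutes inv
    inv-commutes i x = begin
      inv (r′ i x)              ≡⟨ cong (inv ∘ r′ i) (inv-r x) ⟨
      inv (r′ i (fun (inv x)))  ≡⟨ cong inv (commute i (inv x)) ⟨
      inv (fun (r′ i (inv x)))  ≡⟨ inv-l (r′ i (inv x)) ⟩
      r′ i (inv x)              ∎

    restrict-commutes : ∀ j Φ → proj₂ (fun (false , r j Φ)) ≡ r j (proj₂ (fun (false , Φ)))
    restrict-commutes j Φ = cong proj₂ (begin
      fun (false , r j Φ)           ≡⟨ cong fun (r′-old j false Φ) ⟨
      fun (r′ (old j) (false , Φ))  ≡⟨ commute (old j) (false , Φ) ⟩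
      r′ (old j) (fun (false , Φ))  ≡⟨ r′-old j _ _ ⟩
      (proj₁ (fun (false , Φ)) , r j (proj₂ (fun (false , Φ))))  ∎)

    restrict : Automorphism M
    restrict = record
      { fun = λ Φ → proj₂ (fun (false , Φ))
      ; inv = λ Φ → proj₂ (inv (false , Φ))
      ; inv-l = λ Φ → trans (sym (proj₂-bit-irrelevant inv inv-commutes _ _))
                            (cong proj₂ (inv-l (false , Φ)))
      ; inv-r = λ Φ → trans (sym (proj₂-bit-irrelevant fun commute _ _))
                            (cong proj₂ (inv-r (false , Φ)))
      ; commute = restrict-commutes
      }

    restrict-fun : ∀ b Φ → Automorphism.fun restrict Φ ≡ proj₂ (fun (b , Φ))
    restrict-fun b Φ = sym (proj₂-bit-irrelevant fun commute b Φ)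

  xorMap : Bool → (Flag → Flag) → Bool × Flag → Bool × Flag
  xorMap k h (b , Φ) = b xor k , h Φ

  xorMap-commutes : ∀ k h → (∀ j Φ → h (r j Φ) ≡ r j (h Φ)) → Commutes (xorMap k h)
  xorMap-commutes k h h-comm i (b , Φ) with split i
  ... | inj₁ refl = begin
    xorMap k h (r′ new (b , Φ))  ≡⟨ cong (xorMap k h) (r′-new b Φ) ⟩
    (not b xor k , h Φ)          ≡⟨ cong (_, h Φ) (not-distribˡ-xor b k) ⟨
    (not (b xor k) , h Φ)        ≡⟨ r′-new (b xor k) (h Φ) ⟨
    r′ new (b xor k , h Φ)       ∎
  ... | inj₂ (j , refl) = begin
    xorMap k h (r′ (old j) (b , Φ))  ≡⟨ cong (xorMap k h) (r′-old j b Φ) ⟩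
    (b xor k , h (r j Φ))            ≡⟨ cong (b xor k ,_) (h-comm j Φ) ⟩
    (b xor k , r j (h Φ))            ≡⟨ r′-old j (b xor k) (h Φ) ⟨
    r′ (old j) (b xor k , h Φ)       ∎

  lift : Bool → Automorphism M → Automorphism maniplex
  lift k β = record
    { fun = xorMap k fun
    ; inv = xorMap k inv
    ; inv-l = λ (b , Φ) → cong₂ _,_ (xor-cancelʳ b k) (inv-l Φ)
    ; inv-r = λ (b , Φ) → cong₂ _,_ (xor-cancelʳ b k) (inv-r Φ)
    ; commute = xorMap-commutes k fun commute
    }
    where open Automorphism β

  sameOrbit⇔ : ∀ b Φ c Ψ → SameOrbit maniplex (b , Φ) (c , Ψ) ⇔ SameOrbit M Φ Ψ
  sameOrbit⇔ b Φ c Ψ = mk⇔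
    (λ (α , αbΦ≡cΨ) → restrict α , trans (restrict-fun α b Φ) (cong proj₂ αbΦ≡cΨ))
    (λ (β , βΦ≡Ψ) → lift (b xor c) β , cong₂ _,_ (xor-cancelˡ b c) βΦ≡Ψ)

  isSymmetryTypeGraph : ∀ {T} → IsSymmetryTypeGraph M T →
    IsSymmetryTypeGraph maniplex (addSemiEdges T)
  isSymmetryTypeGraph {T} (π , π-surj , π-orbits , π-adj) = π ∘ proj₂ , surj , orbits , adj
    where
    surj : ∀ v → ∃ λ x → π (proj₂ x) ≡ v
    surj v = let Φ , πΦ≡v = π-surj v in (false , Φ) , πΦ≡v

    orbits : ∀ x y → (π (proj₂ x) ≡ π (proj₂ y)) ⇔ SameOrbit maniplex x y
    orbits (b , Φ) (c , Ψ) = ⇔-sym (sameOrbit⇔ b Φ c Ψ) ⇔-∘ π-orbits Φ Ψ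

    adj : ∀ i x → π (proj₂ (r′ i x)) ≡ insert (Pregraph.adj T) id i (π (proj₂ x))
    adj i (b , Φ) with split i
    ... | inj₁ refl =
      trans (cong (π ∘ proj₂) (r′-new b Φ)) (sym (insert-new (Pregraph.adj T) id (π Φ)))
    ... | inj₂ (j , refl) = trans (cong (π ∘ proj₂) (r′-old j b Φ))
      (trans (π-adj j Φ) (sym (insert-old (Pregraph.adj T) id j (π Φ))))

corollary10 : (n : ℕ) (M : Maniplex n) → AtLeastTwoFacets M →
    (T : Pregraph n) → IsSymmetryTypeGraph M T →
    (G : Pregraph (suc n)) → PregraphIso G (procedure1 T) ⊎ PregraphIso G (procedure2 T) →
    Σ (Maniplex (suc n)) λ M′ → IsSymmetryTypeGraph M′ G
corollary10 n M _ T T-sym G (inj₁ G≅procedure1) =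
  maniplex , isSymmetryTypeGraph-resp-iso G≅procedure1
    (isSymmetryTypeGraph-resp-iso (procedure1≅addSemiEdges T) (isSymmetryTypeGraph {T} T-sym))
  where open TrivialExtension (lastLabel n) M
corollary10 n M _ T T-sym G (inj₂ G≅procedure2) =
  maniplex , isSymmetryTypeGraph-resp-iso G≅procedure2
    (isSymmetryTypeGraph-resp-iso (procedure2≅addSemiEdges T) (isSymmetryTypeGraph {T} T-sym))
  where open TrivialExtension (firstLabel n) M
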